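{- A finite simple graph $G$ satisfies $\theta(G)=2$ if and only if $G$ is isomorphic to $K_2$ or to $\overline{K_2}$.
   Context: A vertex coloring is distinguishing if no non-identity automorphism of the graph preserves it. The distinguishing threshold $\theta(G)$ is the minimum number $k$ such that every vertex coloring of $G$ using $k$ colors is distinguishing; equivalently $\theta(G)=1+\max\{c(\alpha):\alpha\in\mathrm{Aut}(G)\}$, where $c(\alpha)$ is the number of cycles (including fixed points) of $\alpha$ as a permutation of $V(G)$ and $c(\mathrm{id})=0$. -}

module Defs where

open import Data.Nat using (ℕ; zero; suc; _+_; _≤_)
open import Data.Nat.Properties using (_≤?_)
open import Data.Bool using (Bool; true; false; not)
open import Data.Fin using (Fin; toℕ; _≟_)
open import Data.Fin.Permutation using (Permutation; Permutation′; _⟨$⟩ʳ_)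
open import Data.List using (List; length; filter)
open import Data.List.Base using (allFin)
open import Data.Product using (Σ; ∃; _×_)
open import Relation.Binary.PropositionalEquality using (_≡_)
open import Relation.Nullary using (Dec; yes; no; ¬_)
open import Relation.Nullary.Decidable using (⌊_⌋)
open import Data.Fin.Properties using (all?)

record Graph : Set where
  field
    n     : ℕ
    adj   : Fin n → Fin n → Bool
    sym   : ∀ u v → adj u v ≡ adj v u
    irrefl : ∀ v → adj v v ≡ false
open Graph public

_≅_ : Graph → Graph → Set
G ≅ H = Σ (Permutation (n G) (n H)) λ φ →
          ∀ u v → adj H (φ ⟨$⟩ʳ u) (φ ⟨$⟩ʳ v) ≡ adj G u v

K₂ : Graph
K₂ = record { n = 2 ; adj = adjK ; sym = symK ; irrefl = irrK }
  where
  adjK : Fin 2 → Fin 2 → Bool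
  adjK u v = not ⌊ u ≟ v ⌋
  symK : ∀ u v → adjK u v ≡ adjK v u
  symK Fin.zero Fin.zero = _≡_.refl
  symK Fin.zero (Fin.suc Fin.zero) = _≡_.refl
  symK (Fin.suc Fin.zero) Fin.zero = _≡_.refl
  symK (Fin.suc Fin.zero) (Fin.suc Fin.zero) = _≡_.refl
  irrK : ∀ v → adjK v v ≡ false
  irrK Fin.zero = _≡_.refl
  irrK (Fin.suc Fin.zero) = _≡_.refl

K₂-complement : Graph
K₂-complement = record { n = 2 ; adj = λ _ _ → false
                       ; sym = λ _ _ → _≡_.refl ; irrefl = λ _ → _≡_.refl }

IsAut : (G : Graph) → Permutation′ (n G) → Set
IsAut G α = ∀ u v → adj G (α ⟨$⟩ʳ u) (α ⟨$⟩ʳ v) ≡ adj G u v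

iter : ∀ {m} → Permutation′ m → ℕ → Fin m → Fin m
iter α zero    v = v
iter α (suc i) v = α ⟨$⟩ʳ (iter α i v)

isCycleMin? : ∀ {m} (α : Permutation′ m) (v : Fin m) →
              Dec (∀ (i : Fin m) → toℕ v ≤ toℕ (iter α (toℕ i) v))
isCycleMin? α v = all? λ i → toℕ v ≤? toℕ (iter α (toℕ i) v)

-- Number of cycles (including fixed points) of a permutation
-- = number of cycles, each counted once via its least element.
cycles : ∀ {m} → Permutation′ m → ℕ
cycles {m} α = length (filter (isCycleMin? α) (allFin m))

isId? : ∀ {m} (α : Permutation′ m) → Dec (∀ v → α ⟨$⟩ʳ v ≡ v)
isId? α = all? λ v → α ⟨$⟩ʳ v ≟ v

c : ∀ {m} → Permutation′ m → ℕ
c α with isId? α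
... | yes _ = 0
... | no  _ = cycles α

-- θ(G) = t, where θ(G) = 1 + max { c(α) : α ∈ Aut(G) }
-- (the maximum is attained since Aut(G) is finite and nonempty).
DistThreshold : Graph → ℕ → Set
DistThreshold G t =
  (∃ λ α → IsAut G α × t ≡ 1 + c α) ×
  (∀ α → IsAut G α → 1 + c α ≤ t)

{-# OPTIONS --safe #-}
module Submission where

-- If θ(G) = 2, some automorphism α consists of a single cycle and no automorphism has
-- more than one cycle, so an automorphism fixing a vertex is the identity. Writing the
-- vertices as αʲ z, the adjacency of αⁱ z and αʲ z depends only on ±(j − i), so the
-- reflection αʲ z ↦ α⁻ʲ z is an automorphism fixing z. Being the identity, it fixes α z,
-- whence α² z = z and G has at most two vertices. Conversely, on two vertices the only
-- non-identity permutation is the transposition, which preserves every graph and has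
-- a single cycle.

open import Defs hiding (sym)
open import Data.Bool using (Bool; true; false)
open import Data.Fin as Fin using (Fin; toℕ)
open import Data.Fin.Induction using (<-wellFounded)
open import Data.Fin.Patterns using (0F; 1F)
open import Data.Fin.Permutation using (Permutation′; _⟨$⟩ʳ_; _≈_; id; permutation; transpose; ↔⇒≡)
open import Data.Fin.Properties using (_≟_; ¬∀⟶∃¬; injective⇒≤)
open import Data.List using (length; allFin)
open import Data.List.Membership.Propositional using (_∈_)
open import Data.List.Membership.Propositional.Properties using (∈-allFin; ∈-filter⁺; ∈-length)
open import Data.List.Properties using (filter-notAll; length-tabulate)
open import Data.List.Relation.Unary.Any as Any using (here; there)
open import Data.Nat using (ℕ; zero; suc; _+_; _≤_; _<_; z≤n; s≤s; s≤s⁻¹)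
open import Data.Nat.Properties using (_≤?_; ≰⇒>; <⇒≱; +-comm; ≤-antisym; ≤-reflexive; m≤n⇒m≤1+n; suc-injective; 0≢1+n)
open import Data.Product using (_×_; _,_; proj₁; proj₂; ∃-syntax)
open import Data.Sum using (_⊎_; inj₁; inj₂; [_,_]′)
open import Function using (_∘_)
open import Function.Bundles using (Injection)
open import Function.Properties.Inverse using (↔⇒↣)
open import Induction.WellFounded using (Acc; acc)
open import Relation.Binary.PropositionalEquality using (_≡_; _≢_; refl; sym; trans; cong; cong₂; subst; module ≡-Reasoning)
open import Relation.Nullary using (yes; no; ¬_; contradiction)
open import Relation.Nullary.Decidable using (decidable-stable)

open ≡-Reasoning

module _ {m} (α : Permutation′ m) where

  ⟨$⟩ʳ-injective : ∀ {x y} → α ⟨$⟩ʳ x ≡ α ⟨$⟩ʳ y → x ≡ y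
  ⟨$⟩ʳ-injective = Injection.injective (↔⇒↣ α)

  iter-+ : ∀ i j v → iter α (i + j) v ≡ iter α i (iter α j v)
  iter-+ zero    j v = refl
  iter-+ (suc i) j v = cong (α ⟨$⟩ʳ_) (iter-+ i j v)

  iter-comm : ∀ i j v → iter α i (iter α j v) ≡ iter α j (iter α i v)
  iter-comm i j v = begin
    iter α i (iter α j v) ≡⟨ iter-+ i j v ⟨
    iter α (i + j) v      ≡⟨ cong (λ k → iter α k v) (+-comm i j) ⟩
    iter α (j + i) v      ≡⟨ iter-+ j i v ⟩
    iter α j (iter α i v) ∎

  iter-suc : ∀ k v → iter α (suc k) v ≡ iter α k (α ⟨$⟩ʳ v)
  iter-suc zero    v = refl
  iter-suc (suc k) v = cong (α ⟨$⟩ʳ_) (iter-suc k v)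

  iter-injective : ∀ k {x y} → iter α k x ≡ iter α k y → x ≡ y
  iter-injective zero    eq = eq
  iter-injective (suc k) eq = iter-injective k (⟨$⟩ʳ-injective eq)

  iter-fixed : ∀ {z} → α ⟨$⟩ʳ z ≡ z → ∀ k → iter α k z ≡ z
  iter-fixed αz≡z zero    = refl
  iter-fixed αz≡z (suc k) = trans (cong (α ⟨$⟩ʳ_) (iter-fixed αz≡z k)) αz≡z

  orbit-of-period-2 : ∀ {z} → α ⟨$⟩ʳ (α ⟨$⟩ʳ z) ≡ z →
                      ∀ k v → iter α k v ≡ z → v ≡ z ⊎ v ≡ α ⟨$⟩ʳ z
  orbit-of-period-2 α²z≡z zero    v eq = inj₁ eq
  orbit-of-period-2 α²z≡z (suc k) v eq
    with orbit-of-period-2 α²z≡z k (α ⟨$⟩ʳ v) (trans (sym (iter-suc k v)) eq)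
  ... | inj₁ αv≡z  = inj₂ (⟨$⟩ʳ-injective (trans αv≡z (sym α²z≡z)))
  ... | inj₂ αv≡αz = inj₁ (⟨$⟩ʳ-injective αv≡αz)

iter-preserves-adj : (G : Graph) {α : Permutation′ (n G)} → IsAut G α →
                     ∀ k u v → adj G (iter α k u) (iter α k v) ≡ adj G u v
iter-preserves-adj G α-aut zero    u v = refl
iter-preserves-adj G α-aut (suc k) u v = trans (α-aut _ _) (iter-preserves-adj G α-aut k u v)

IsCycleMin : ∀ {m} → Permutation′ m → Fin m → Set
IsCycleMin {m} α v = ∀ (i : Fin m) → toℕ v ≤ toℕ (iter α (toℕ i) v)

distinct-members⇒2≤length : ∀ {A : Set} {x y : A} {xs} → x ∈ xs → y ∈ xs → x ≢ y → 2 ≤ length xs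
distinct-members⇒2≤length (here refl) (here refl) x≢y = contradiction refl x≢y
distinct-members⇒2≤length (here _)    (there y∈)  _   = s≤s (∈-length y∈)
distinct-members⇒2≤length (there x∈)  (here _)    _   = s≤s (∈-length x∈)
distinct-members⇒2≤length (there x∈)  (there y∈)  x≢y =
  m≤n⇒m≤1+n (distinct-members⇒2≤length x∈ y∈ x≢y)

module _ {m} (α : Permutation′ m) where

  distinct-cycleMins⇒2≤cycles : ∀ {x y} → x ≢ y → IsCycleMin α x → IsCycleMin α y → 2 ≤ cycles α
  distinct-cycleMins⇒2≤cycles {x} {y} x≢y x-min y-min = distinct-members⇒2≤length
    (∈-filter⁺ (isCycleMin? α) (∈-allFin x) x-min)
    (∈-filter⁺ (isCycleMin? α) (∈-allFin y) y-min) x≢y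

  ¬cycleMin⇒cycles<order : ∀ {v} → ¬ IsCycleMin α v → cycles α < m
  ¬cycleMin⇒cycles<order {v} ¬v-min = subst (cycles α <_) (length-tabulate Function.id)
    (filter-notAll (isCycleMin? α) (allFin m) (Any.map (λ { refl → ¬v-min }) (∈-allFin v)))

  reaches-cycleMin : ∀ v → ∃[ k ] IsCycleMin α (iter α k v)
  reaches-cycleMin v = descend v (<-wellFounded v)
    where
    descend : ∀ v → Acc Fin._<_ v → ∃[ k ] IsCycleMin α (iter α k v)
    descend v (acc smaller) with isCycleMin? α v
    ... | yes v-min = 0 , v-min
    ... | no ¬v-min with ¬∀⟶∃¬ m _ (λ i → toℕ v ≤? toℕ (iter α (toℕ i) v)) ¬v-min
    ... | i , v≰αⁱv with descend (iter α (toℕ i) v) (smaller (≰⇒> v≰αⁱv))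
    ... | k , min = k + toℕ i , subst (IsCycleMin α) (sym (iter-+ α k (toℕ i) v)) min

  cycles≤1⇒reaches : cycles α ≤ 1 → ∀ {z} → IsCycleMin α z → ∀ v → ∃[ k ] iter α k v ≡ z
  cycles≤1⇒reaches cycles≤1 {z} z-min v with reaches-cycleMin v
  ... | k , min with iter α k v ≟ z
  ...   | yes αᵏv≡z = k , αᵏv≡z
  ...   | no  αᵏv≢z = contradiction cycles≤1 (<⇒≱ (distinct-cycleMins⇒2≤cycles αᵏv≢z min z-min))

  fixed⇒cycleMin : ∀ {z} → α ⟨$⟩ʳ z ≡ z → IsCycleMin α z
  fixed⇒cycleMin αz≡z i = ≤-reflexive (cong toℕ (sym (iter-fixed α αz≡z (toℕ i))))

  cycles≤1-fixes⇒singleton : cycles α ≤ 1 → ∀ {z} → α ⟨$⟩ʳ z ≡ z → ∀ v → v ≡ z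
  cycles≤1-fixes⇒singleton cycles≤1 αz≡z v with cycles≤1⇒reaches cycles≤1 (fixed⇒cycleMin αz≡z) v
  ... | k , αᵏv≡z = iter-injective α k (trans αᵏv≡z (sym (iter-fixed α αz≡z k)))

  c-id : α ≈ id → c α ≡ 0
  c-id α≈id with isId? α
  ... | yes _    = refl
  ... | no  α≉id = contradiction α≈id α≉id

  c-non-id : ¬ α ≈ id → c α ≡ cycles α
  c-non-id α≉id with isId? α
  ... | yes α≈id = contradiction α≈id α≉id
  ... | no  _    = refl

  c≤1-fixes⇒id : c α ≤ 1 → ∀ {z} → α ⟨$⟩ʳ z ≡ z → α ≈ id
  c≤1-fixes⇒id c≤1 {z} αz≡z = decidable-stable (isId? α) λ α≉id → α≉id λ v →
    let trivial = cycles≤1-fixes⇒singleton (subst (_≤ 1) (c-non-id α≉id) c≤1) αz≡z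
    in begin
      α ⟨$⟩ʳ v ≡⟨ cong (α ⟨$⟩ʳ_) (trivial v) ⟩
      α ⟨$⟩ʳ z ≡⟨ αz≡z ⟩
      z        ≡⟨ trivial v ⟨
      v        ∎

-- If v = αʲ z then dist v ≡ −j modulo the length of the cycle, so reflect sends αʲ z
-- to α⁻ʲ z: it is the reflection of the cycle of α through z.
module Reflection (G : Graph) {α : Permutation′ (n G)} (α-aut : IsAut G α)
                  {z : Fin (n G)} (reaches : ∀ v → ∃[ k ] iter α k v ≡ z) where

  private
    dist : Fin (n G) → ℕ
    dist v = proj₁ (reaches v)

    dist-reaches : ∀ v → iter α (dist v) v ≡ z
    dist-reaches v = proj₂ (reaches v)

  reflect : Fin (n G) → Fin (n G)
  reflect v = iter α (dist v) z

  reflect-involutive : ∀ v → reflect (reflect v) ≡ v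
  reflect-involutive v = iter-injective α (dist v) (begin
    iter α (dist v) (iter α (dist w) z) ≡⟨ iter-comm α (dist v) (dist w) z ⟩
    iter α (dist w) w                   ≡⟨ dist-reaches w ⟩
    z                                   ≡⟨ dist-reaches v ⟨
    iter α (dist v) v                   ∎)
    where
    w = reflect v

  reflection : Permutation′ (n G)
  reflection = permutation reflect reflect reflect-involutive reflect-involutive

  reflection-fixes : reflection ⟨$⟩ʳ z ≡ z
  reflection-fixes = dist-reaches z

  reflection-aut : IsAut G reflection
  reflection-aut u v = begin
    adj G (iter α p z) (iter α q z)                       ≡⟨ Graph.sym G _ _ ⟩
    adj G (iter α q z) (iter α p z)                       ≡⟨ cong₂ (adj G) (cong (iter α q) (dist-reaches u))
                                                                           (cong (iter α p) (dist-reaches v)) ⟨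
    adj G (iter α q (iter α p u)) (iter α p (iter α q v)) ≡⟨ cong (adj G _) (iter-comm α p q v) ⟩
    adj G (iter α q (iter α p u)) (iter α q (iter α p v)) ≡⟨ iter-preserves-adj G α-aut q _ _ ⟩
    adj G (iter α p u) (iter α p v)                       ≡⟨ iter-preserves-adj G α-aut p u v ⟩
    adj G u v                                             ∎
    where
    p = dist u
    q = dist v

  reflection-fixes-αz⇒period-2 : reflection ⟨$⟩ʳ (α ⟨$⟩ʳ z) ≡ α ⟨$⟩ʳ z → α ⟨$⟩ʳ (α ⟨$⟩ʳ z) ≡ z
  reflection-fixes-αz⇒period-2 fixes = begin
    α ⟨$⟩ʳ (α ⟨$⟩ʳ z)  ≡⟨ cong (α ⟨$⟩ʳ_) fixes ⟨
    iter α (suc d) z   ≡⟨ iter-suc α d z ⟩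
    iter α d (α ⟨$⟩ʳ z) ≡⟨ dist-reaches (α ⟨$⟩ʳ z) ⟩
    z                  ∎
    where
    d = dist (α ⟨$⟩ʳ z)

distinct⇒2≤order : ∀ {m} {x y : Fin m} → x ≢ y → 2 ≤ m
distinct⇒2≤order {zero}        {()}
distinct⇒2≤order {suc zero}    {Fin.zero} {Fin.zero} x≢y = contradiction refl x≢y
distinct⇒2≤order {suc (suc _)} _ = s≤s (s≤s z≤n)

covered-by-two⇒order≤2 : ∀ {m} (x y : Fin m) → (∀ v → v ≡ x ⊎ v ≡ y) → m ≤ 2
covered-by-two⇒order≤2 x y covered =
  injective⇒≤ {f = side ∘ covered} λ {u} {v} → same-side (covered u) (covered v)
  where
  side : ∀ {v} → v ≡ x ⊎ v ≡ y → Fin 2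
  side (inj₁ _) = 0F
  side (inj₂ _) = 1F

  same-side : ∀ {u v} (cu : u ≡ x ⊎ u ≡ y) (cv : v ≡ x ⊎ v ≡ y) → side cu ≡ side cv → u ≡ v
  same-side (inj₁ refl) (inj₁ refl) _ = refl
  same-side (inj₂ refl) (inj₂ refl) _ = refl
  same-side (inj₁ _)    (inj₂ _)    ()
  same-side (inj₂ _)    (inj₁ _)    ()

c≤1-automorphisms⇒order≤2 : (G : Graph) → (∀ γ → IsAut G γ → c γ ≤ 1) →
                            ∀ {α} → IsAut G α → cycles α ≤ 1 → ∀ {z} → IsCycleMin α z → n G ≤ 2
c≤1-automorphisms⇒order≤2 G c≤1 {α} α-aut cycles≤1 {z} z-min =
  covered-by-two⇒order≤2 z (α ⟨$⟩ʳ z) λ v →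
    orbit-of-period-2 α α²z≡z (proj₁ (reaches v)) v (proj₂ (reaches v))
  where
  reaches : ∀ v → ∃[ k ] iter α k v ≡ z
  reaches = cycles≤1⇒reaches α cycles≤1 z-min

  open Reflection G α-aut reaches

  α²z≡z : α ⟨$⟩ʳ (α ⟨$⟩ʳ z) ≡ z
  α²z≡z = reflection-fixes-αz⇒period-2
    (c≤1-fixes⇒id reflection (c≤1 reflection reflection-aut) reflection-fixes (α ⟨$⟩ʳ z))

threshold-2⇒order-2 : (G : Graph) → DistThreshold G 2 → n G ≡ 2
threshold-2⇒order-2 G ((α , α-aut , 2≡1+cα) , bound) =
  ≤-antisym (c≤1-automorphisms⇒order≤2 G c≤1 α-aut cycles≤1
                                        (proj₂ (reaches-cycleMin α (proj₁ moved))))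
            (distinct⇒2≤order (proj₂ moved))
  where
  cα≡1 : c α ≡ 1
  cα≡1 = suc-injective (sym 2≡1+cα)

  α≉id : ¬ α ≈ id
  α≉id α≈id = 0≢1+n (trans (sym (c-id α α≈id)) cα≡1)

  cycles≤1 : cycles α ≤ 1
  cycles≤1 = ≤-reflexive (trans (sym (c-non-id α α≉id)) cα≡1)

  c≤1 : ∀ γ → IsAut G γ → c γ ≤ 1
  c≤1 γ γ-aut = s≤s⁻¹ (bound γ γ-aut)

  moved : ∃[ v ] α ⟨$⟩ʳ v ≢ v
  moved = ¬∀⟶∃¬ _ _ (λ v → α ⟨$⟩ʳ v ≟ v) α≉id

Fin2-adjacency-determined : {a b : Fin 2 → Fin 2 → Bool} →
                            (∀ u v → a u v ≡ a v u) → (∀ u v → b u v ≡ b v u) →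
                            (∀ v → a v v ≡ false) → (∀ v → b v v ≡ false) →
                            a 0F 1F ≡ b 0F 1F → ∀ u v → a u v ≡ b u v
Fin2-adjacency-determined a-sym b-sym a-irrefl b-irrefl a₀₁≡b₀₁ = λ where
  0F 0F → trans (a-irrefl 0F) (sym (b-irrefl 0F))
  0F 1F → a₀₁≡b₀₁
  1F 0F → trans (a-sym 1F 0F) (trans a₀₁≡b₀₁ (b-sym 0F 1F))
  1F 1F → trans (a-irrefl 1F) (sym (b-irrefl 1F))

Fin2-non-id : (γ : Permutation′ 2) → ¬ γ ≈ id → γ ⟨$⟩ʳ 1F ≡ 0F
Fin2-non-id γ γ≉id with γ ⟨$⟩ʳ 1F in γ₁ | γ ⟨$⟩ʳ 0F in γ₀
... | 0F | _  = refl
... | 1F | 0F = contradiction (λ where 0F → γ₀; 1F → γ₁) γ≉id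
... | 1F | 1F = contradiction (⟨$⟩ʳ-injective γ (trans γ₀ (sym γ₁))) λ ()

c≤1-on-Fin2 : (γ : Permutation′ 2) → c γ ≤ 1
c≤1-on-Fin2 γ with isId? γ
... | yes _    = z≤n
... | no  γ≉id = s≤s⁻¹ (¬cycleMin⇒cycles<order γ ¬1-min)
  where
  ¬1-min : ¬ IsCycleMin γ 1F
  ¬1-min 1-min = contradiction (subst (λ w → 1 ≤ toℕ w) (Fin2-non-id γ γ≉id) (1-min 1F)) λ ()

order-2⇒threshold-2 : (G : Graph) → n G ≡ 2 → DistThreshold G 2
order-2⇒threshold-2 record { n = .2 ; adj = a ; sym = a-sym ; irrefl = a-irrefl } refl =
  (transpose 0F 1F , transposition-aut , refl) , λ γ _ → s≤s (c≤1-on-Fin2 γ)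
  where
  transposition-aut : ∀ u v → a (transpose 0F 1F ⟨$⟩ʳ u) (transpose 0F 1F ⟨$⟩ʳ v) ≡ a u v
  transposition-aut =
    Fin2-adjacency-determined (λ _ _ → a-sym _ _) a-sym (λ _ → a-irrefl _) a-irrefl (a-sym 1F 0F)

order-2-classification : (G : Graph) → n G ≡ 2 → (G ≅ K₂) ⊎ (G ≅ K₂-complement)
order-2-classification record { n = .2 ; adj = a ; sym = a-sym ; irrefl = a-irrefl } refl
  with a 0F 1F in a₀₁
... | true  = inj₁ (id , Fin2-adjacency-determined (Graph.sym K₂) a-sym
                                                   (irrefl K₂) a-irrefl (sym a₀₁))
... | false = inj₂ (id , Fin2-adjacency-determined (Graph.sym K₂-complement) a-sym
                                                   (irrefl K₂-complement) a-irrefl (sym a₀₁))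

theorem3p3 : (G : Graph) →
    (DistThreshold G 2 → (G ≅ K₂) ⊎ (G ≅ K₂-complement)) ×
    ((G ≅ K₂) ⊎ (G ≅ K₂-complement) → DistThreshold G 2)
theorem3p3 G = order-2-classification G ∘ threshold-2⇒order-2 G
             , order-2⇒threshold-2 G ∘ [ ↔⇒≡ ∘ proj₁ , ↔⇒≡ ∘ proj₁ ]′
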